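{- Let $t : \mathbb{N} \to \mathbb{N}$ be a C-recursive sequence whose generating function is $\sum_{n \geq 0} t(n) z^n = A(z)/B(z)$ with $A, B \in \mathbb{Z}[x]$, $B(x) = 1 + a_1 x + \dots + a_d x^d$, $a_d \neq 0$, $\deg A < \deg B = d$, and the free terms of $A$ and $B$ positive. Put $\tilde A(x) = x^d A(1/x)$ and $\tilde B(x) = x^d B(1/x)$, and let $\alpha_d \neq 0$ denote the free (constant) term of $\tilde B$. Suppose there is $c \in \mathbb{N}$ such that for all integers $n \geq 1$, $$t(n) = \left\lfloor \frac{c^{n^2} \tilde A(c^n)}{\tilde B(c^n)} \right\rfloor \bmod c^n.$$ Then there exists an integer $e \geq c$ such that for all $n \geq 1$: $$t(n) = \frac{ -1 - \operatorname{sgn}(\alpha_d)}{2} + \frac{1}{|\alpha_d|}\left( \left( \left(- \operatorname{sgn}(\alpha_d) \cdot e^{n^2} \tilde A(e^n)\right) \bmod \tilde B(e^n) \right) \bmod e^n \right).$$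
   Context: $\mathbb{N}$ includes $0$. A sequence $t:\mathbb{N}\to\mathbb{C}$ is C-recursive of order $d$ if $t(n+d) + a_1 t(n+d-1) + \dots + a_d t(n) = 0$ for all $n \in \mathbb{N}$, with constant coefficients $a_i$. For integers $x$ and $m \geq 1$, $x \bmod m$ denotes the least nonnegative residue of $x$ modulo $m$. $\lfloor \cdot \rfloor$ is the floor function and $\operatorname{sgn}$ the sign function. -}

module Defs where

open import Data.Nat as ℕ using (ℕ; zero; suc; _∸_)
open import Data.Integer as ℤ using (ℤ; +_; -[1+_]; +[1+_]; _%ℕ_)
open import Data.Rational as ℚ using (ℚ)
open import Data.Vec as Vec using (Vec; []; _∷_; _∷ʳ_)

-- Polynomials with integer coefficients are coefficient vectors,
-- lowest degree first:  (p₀ ∷ p₁ ∷ … ∷ pₖ₋₁ ∷ [])  ↦  p₀ + p₁ x + … .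

eval : ∀ {k} → Vec ℤ k → ℤ → ℤ
eval []       x = + 0
eval (p ∷ ps) x = p ℤ.+ x ℤ.* eval ps x

coeff : ∀ {k} → Vec ℤ k → ℕ → ℤ
coeff []       i       = + 0
coeff (p ∷ ps) zero    = p
coeff (p ∷ ps) (suc i) = coeff ps i

sumTo : ℕ → (ℕ → ℤ) → ℤ
sumTo zero    f = f 0
sumTo (suc n) f = sumTo n f ℤ.+ f (suc n)

-- n-th coefficient of the formal power series  p(z) · Σ_{m ≥ 0} t(m) zᵐ
cauchy : ∀ {k} → Vec ℤ k → (ℕ → ℕ) → ℕ → ℤ
cauchy p t n = sumTo n (λ i → coeff p i ℤ.* + (t (n ∸ i)))

Bpoly : ∀ {d} → Vec ℤ d → Vec ℤ (suc d)
Bpoly a = + 1 ∷ a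

-- A (degree < d, coefficients A₀ … A_{d-1}) viewed with d+1 coefficient slots
Apoly : ∀ {d} → Vec ℤ d → Vec ℤ (suc d)
Apoly A = A ∷ʳ + 0

-- x^d p(1/x) for a polynomial p of degree ≤ d (d+1 coefficient slots):
-- the coefficient vector reversed
recip : ∀ {d} → Vec ℤ (suc d) → Vec ℤ (suc d)
recip = Vec.reverse

tildeA : ∀ {d} → Vec ℤ d → Vec ℤ (suc d)
tildeA A = recip (Apoly A)

tildeB : ∀ {d} → Vec ℤ d → Vec ℤ (suc d)
tildeB a = recip (Bpoly a)

alpha : ∀ {d} → Vec ℤ d → ℤ
alpha a = coeff (tildeB a) 0

sgn : ℤ → ℤ
sgn (+ zero)   = + 0
sgn +[1+ _ ]   = + 1
sgn -[1+ _ ]   = ℤ.- (+ 1)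

-- ⌊ p / q ⌋ (floor of the rational p/q); junk value 0 when q = 0
fdiv : ℤ → ℤ → ℤ
fdiv p (+ zero)   = + 0
fdiv p +[1+ k ]   = ℚ.floor (p ℚ./ suc k)
fdiv p -[1+ k ]   = ℚ.floor ((ℤ.- p) ℚ./ suc k)

-- x mod m, least nonnegative residue, for m ≥ 1; junk value 0 when m ≤ 0
modZ : ℤ → ℤ → ℤ
modZ x (+ zero)   = + 0
modZ x +[1+ k ]   = + (x %ℕ suc k)
modZ x -[1+ k ]   = + 0

-- the rational number p / q; junk value 0 when q = 0
qdiv : ℤ → ℤ → ℚ
qdiv p (+ zero)   = ℚ.0ℚ
qdiv p +[1+ k ]   = p ℚ./ suc k
qdiv p -[1+ k ]   = (ℤ.- p) ℚ./ suc k

{-# OPTIONS --safe #-}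
-- Fix n ≥ 1 and put x = eⁿ. Multiplying out B(z) · Σ t(i) zⁱ = A(z) and cutting the series
-- after zⁿ gives the exact division  xⁿ Ã(x) = B̃(x) · P + Q  with P = Σ_{i≤n} t(i) x^(n-i) and
-- Q = Σ_{j<d} r_j x^(d-1-j), where r_j is the coefficient of z^(n+1+j) in B(z) · Σ_{i>n} t(i) zⁱ.
-- The r_j grow only geometrically in n, so for large e the number |Q| is far below B̃(x) ≈ x^d.
-- Moreover Q > 0: since x · Q_m = B̃(x) · t(m+1) + Q_{m+1} and |Q_{m+1}| < B̃(x), Q_m is positive
-- once t(m+1) > 0 and has the sign of Q_{m+1} otherwise, while t cannot vanish at d consecutive
-- places, as a_d ≠ 0 lets the recurrence run backwards down to t(0) = A(0) > 0.
-- So Q is the residue of xⁿ Ã(x) and B̃(x) - Q that of -xⁿ Ã(x) modulo B̃(x). Modulo x we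
-- have xⁿ Ã(x) ≡ 0, P ≡ t(n) and B̃(x) ≡ α_d, hence Q ≡ -α_d t(n) and B̃(x) - Q ≡ α_d (t(n) + 1),
-- and |α_d| (t(n) + 1) < x makes the residue modulo x equal to |α_d| t(n) when α_d < 0 and
-- to |α_d| (t(n) + 1) when α_d > 0.
module Submission where

open import Defs
open import Data.Nat as ℕ using (ℕ; zero; suc; _∸_; _≤_; _<_; z≤n; s≤s)
import Data.Nat.Properties as ℕP
import Data.Nat.Tactic.RingSolver as ℕSolver
open import Data.Integer as ℤ
  using (ℤ; +_; -[1+_]; +[1+_]; +≤+; +<+; ∣_∣; _+_; _-_; _*_; -_; _^_)
import Data.Integer.Properties as ℤP
import Data.Integer.DivMod as ℤD
open import Data.Integer.Tactic.RingSolver using (solve-∀)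
open import Data.Rational as ℚ using (ℚ)
import Data.Rational.Properties as ℚP
open import Data.Rational.Unnormalised as ℚᵘ using (*≡*)
import Data.Rational.Unnormalised.Properties as ℚᵘP
open import Data.Vec as Vec using (Vec; []; _∷_; _∷ʳ_)
import Data.Vec.Properties as VecP
open import Data.Product using (Σ; ∃; _×_; _,_; proj₁; proj₂)
open import Data.Sum using (inj₁; inj₂)
open import Function using (_∘_)
open import Relation.Nullary using (¬_; yes; no; ¬?; contradiction)
open import Relation.Nullary.Decidable using (decidable-stable)
open import Relation.Binary.PropositionalEquality

revEval : (ℕ → ℤ) → ℤ → ℕ → ℤ
revEval f x zero    = f 0
revEval f x (suc k) = x * revEval f x k + f (suc k)

revEval-cong : ∀ {f g} x k → (∀ i → f i ≡ g i) → revEval f x k ≡ revEval g x k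
revEval-cong x zero    f≗g = f≗g 0
revEval-cong x (suc k) f≗g = cong₂ (λ u v → x * u + v) (revEval-cong x k f≗g) (f≗g (suc k))

revEval-leading : ∀ f x k → revEval f x (suc k) ≡ f 0 * x ^ suc k + revEval (f ∘ suc) x k
revEval-leading f x zero    = ring (f 0) (f 1) x
  where
  ring : ∀ a b x → x * a + b ≡ a * (x * + 1) + b
  ring = solve-∀
revEval-leading f x (suc k) = begin
  x * revEval f x (suc k) + f (2 ℕ.+ k)
    ≡⟨ cong (λ u → x * u + f (2 ℕ.+ k)) (revEval-leading f x k) ⟩
  x * (f 0 * x ^ suc k + revEval (f ∘ suc) x k) + f (2 ℕ.+ k)
    ≡⟨ ring (f 0) (x ^ suc k) (revEval (f ∘ suc) x k) (f (2 ℕ.+ k)) x ⟩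
  f 0 * x ^ (2 ℕ.+ k) + revEval (f ∘ suc) x (suc k) ∎
  where
  open ≡-Reasoning
  ring : ∀ a y g c x → x * (a * y + g) + c ≡ a * (x * y) + (x * g + c)
  ring = solve-∀

powSum : ℕ → ℕ → ℕ
powSum X zero    = 0
powSum X (suc k) = X ℕ.* powSum X k ℕ.+ 1

[1+y]^k≡y*powSum+1 : ∀ y k → suc y ℕ.^ k ≡ y ℕ.* powSum (suc y) k ℕ.+ 1
[1+y]^k≡y*powSum+1 y zero    = cong (ℕ._+ 1) (sym (ℕP.*-zeroʳ y))
[1+y]^k≡y*powSum+1 y (suc k) = trans (cong (suc y ℕ.*_) ([1+y]^k≡y*powSum+1 y k)) (ring y (powSum (suc y) k))
  where
  ring : ∀ y s → (1 ℕ.+ y) ℕ.* (y ℕ.* s ℕ.+ 1) ≡ y ℕ.* ((1 ℕ.+ y) ℕ.* s ℕ.+ 1) ℕ.+ 1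
  ring = ℕSolver.solve-∀

revEval-tail-bound : ∀ f X V k → (∀ j → ∣ f (suc j) ∣ ≤ V) →
                     ∣ revEval f (+ X) k - f 0 * (+ X) ^ k ∣ ≤ V ℕ.* powSum X k
revEval-tail-bound f X V zero    _     = ℕP.≤-reflexive (trans (cong ∣_∣ (ring (f 0))) (sym (ℕP.*-zeroʳ V)))
  where
  ring : ∀ a → a - a * + 1 ≡ + 0
  ring = solve-∀
revEval-tail-bound f X V (suc k) ∣f∣≤V = begin
  ∣ revEval f x (suc k) - f 0 * x ^ suc k ∣ ≡⟨ cong ∣_∣ (ring x (revEval f x k) (f 0) (x ^ k) (f (suc k))) ⟩
  ∣ x * D + f (suc k) ∣                    ≤⟨ ℤP.∣i+j∣≤∣i∣+∣j∣ (x * D) (f (suc k)) ⟩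
  ∣ x * D ∣ ℕ.+ ∣ f (suc k) ∣              ≡⟨ cong (ℕ._+ ∣ f (suc k) ∣) (ℤP.abs-* x D) ⟩
  X ℕ.* ∣ D ∣ ℕ.+ ∣ f (suc k) ∣            ≤⟨ ℕP.+-mono-≤ (ℕP.*-monoʳ-≤ X (revEval-tail-bound f X V k ∣f∣≤V)) (∣f∣≤V k) ⟩
  X ℕ.* (V ℕ.* powSum X k) ℕ.+ V           ≡⟨ ringℕ X V (powSum X k) ⟩
  V ℕ.* powSum X (suc k)                   ∎
  where
  open ℕP.≤-Reasoning
  x = + X
  D = revEval f x k - f 0 * x ^ k
  ring : ∀ x g a y c → x * g + c - a * (x * y) ≡ x * (g - a * y) + c
  ring = solve-∀
  ringℕ : ∀ X V s → X ℕ.* (V ℕ.* s) ℕ.+ V ≡ V ℕ.* (X ℕ.* s ℕ.+ 1)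
  ringℕ = ℕSolver.solve-∀

eval-∷ʳ : ∀ {k} (v : Vec ℤ k) p x → eval (v ∷ʳ p) x ≡ eval v x + x ^ k * p
eval-∷ʳ []      p x = ring p x
  where
  ring : ∀ p x → p + x * + 0 ≡ + 0 + + 1 * p
  ring = solve-∀
eval-∷ʳ {suc k} (q ∷ v) p x = begin
  q + x * eval (v ∷ʳ p) x        ≡⟨ cong (λ u → q + x * u) (eval-∷ʳ v p x) ⟩
  q + x * (eval v x + x ^ k * p) ≡⟨ ring q x (eval v x) (x ^ k) p ⟩
  q + x * eval v x + x ^ suc k * p ∎
  where
  open ≡-Reasoning
  ring : ∀ q x e y p → q + x * (e + y * p) ≡ q + x * e + x * y * p
  ring = solve-∀

eval-reverse : ∀ {k} (v : Vec ℤ (suc k)) x → eval (Vec.reverse v) x ≡ revEval (coeff v) x k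
eval-reverse {zero}  (p ∷ []) x = ring p x
  where
  ring : ∀ p x → p + x * + 0 ≡ p
  ring = solve-∀
eval-reverse {suc k} (p ∷ v)  x = begin
  eval (Vec.reverse (p ∷ v)) x            ≡⟨ cong (λ w → eval w x) (VecP.reverse-∷ p v) ⟩
  eval (Vec.reverse v ∷ʳ p) x             ≡⟨ eval-∷ʳ (Vec.reverse v) p x ⟩
  eval (Vec.reverse v) x + x ^ suc k * p  ≡⟨ cong (_+ x ^ suc k * p) (eval-reverse v x) ⟩
  revEval (coeff v) x k + x ^ suc k * p   ≡⟨ ring (revEval (coeff v) x k) (x ^ suc k) p ⟩
  p * x ^ suc k + revEval (coeff v) x k   ≡⟨ revEval-leading (coeff (p ∷ v)) x k ⟨
  revEval (coeff (p ∷ v)) x (suc k)       ∎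
  where
  open ≡-Reasoning
  ring : ∀ g y p → g + y * p ≡ p * y + g
  ring = solve-∀

coeff₀-∷ʳ : ∀ {k} (v : Vec ℤ (suc k)) p → coeff (v ∷ʳ p) 0 ≡ coeff v 0
coeff₀-∷ʳ (q ∷ v) p = refl

coeff₀-reverse : ∀ {k} (v : Vec ℤ (suc k)) → coeff (Vec.reverse v) 0 ≡ coeff v k
coeff₀-reverse {zero}  (p ∷ [])    = refl
coeff₀-reverse {suc k} (p ∷ q ∷ v) = begin
  coeff (Vec.reverse (p ∷ q ∷ v)) 0     ≡⟨ cong (λ w → coeff w 0) (VecP.reverse-∷ p (q ∷ v)) ⟩
  coeff (Vec.reverse (q ∷ v) ∷ʳ p) 0    ≡⟨ coeff₀-∷ʳ (Vec.reverse (q ∷ v)) p ⟩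
  coeff (Vec.reverse (q ∷ v)) 0         ≡⟨ coeff₀-reverse (q ∷ v) ⟩
  coeff (q ∷ v) k                       ∎
  where open ≡-Reasoning

coeff-∷ʳ-+0 : ∀ {k} (v : Vec ℤ k) i → coeff (v ∷ʳ + 0) i ≡ coeff v i
coeff-∷ʳ-+0 []      zero    = refl
coeff-∷ʳ-+0 []      (suc i) = refl
coeff-∷ʳ-+0 (p ∷ v) zero    = refl
coeff-∷ʳ-+0 (p ∷ v) (suc i) = coeff-∷ʳ-+0 v i

coeff-beyond : ∀ {k} (v : Vec ℤ k) i → k ≤ i → coeff v i ≡ + 0
coeff-beyond []      i       _         = refl
coeff-beyond (p ∷ v) (suc i) (s≤s k≤i) = coeff-beyond v i k≤i

coeff-bounded : ∀ {k} (v : Vec ℤ k) → ∃ λ M → ∀ i → ∣ coeff v i ∣ ≤ M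
coeff-bounded []      = 0 , λ _ → z≤n
coeff-bounded (p ∷ v) with coeff-bounded v
... | M , bound = ∣ p ∣ ℕ.+ M , λ
  { zero    → ℕP.m≤m+n ∣ p ∣ M
  ; (suc i) → ℕP.≤-trans (bound i) (ℕP.m≤n+m M ∣ p ∣) }

sumTo-cong : ∀ {f g} n → (∀ i → f i ≡ g i) → sumTo n f ≡ sumTo n g
sumTo-cong zero    f≗g = f≗g 0
sumTo-cong (suc n) f≗g = cong₂ _+_ (sumTo-cong n f≗g) (f≗g (suc n))

sumTo-+-zeros : ∀ {f} j l → (∀ i → j < i → f i ≡ + 0) → sumTo (j ℕ.+ l) f ≡ sumTo j f
sumTo-+-zeros {f} j zero    _     = cong (λ n → sumTo n f) (ℕP.+-identityʳ j)
sumTo-+-zeros {f} j (suc l) zeros = begin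
  sumTo (j ℕ.+ suc l) f                    ≡⟨ cong (λ n → sumTo n f) (ℕP.+-suc j l) ⟩
  sumTo (j ℕ.+ l) f + f (suc (j ℕ.+ l))    ≡⟨ cong₂ _+_ (sumTo-+-zeros j l zeros) (zeros _ (s≤s (ℕP.m≤m+n j l))) ⟩
  sumTo j f + + 0                          ≡⟨ ℤP.+-identityʳ _ ⟩
  sumTo j f                                ∎
  where open ≡-Reasoning

pos-^ : ∀ m n → (+ m) ^ n ≡ + (m ℕ.^ n)
pos-^ m zero    = refl
pos-^ m (suc n) = trans (cong (+ m *_) (pos-^ m n)) (sym (ℤP.pos-* m (m ℕ.^ n)))

0<n+i : ∀ {n} i → ∣ i ∣ < n → + 0 ℤ.< + n + i
0<n+i {suc n} (+ i)      _       = +<+ (s≤s z≤n)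
0<n+i {n}     -[1+ i ]   1+i<n   = subst (+ 0 ℤ.<_) (sym (ℤP.⊖-≥ (ℕP.<⇒≤ 1+i<n))) (+<+ (ℕP.m<n⇒0<n∸m 1+i<n))

0<n+i+j : ∀ {n} i j → ∣ i ∣ ℕ.+ ∣ j ∣ < n → + 0 ℤ.< + n + i + j
0<n+i+j {n} i j small = subst (+ 0 ℤ.<_) (sym (ℤP.+-assoc (+ n) i j))
                              (0<n+i (i + j) (ℕP.≤-<-trans (ℤP.∣i+j∣≤∣i∣+∣j∣ i j) small))

0<[1+x]*i⇒0<i : ∀ x {i} → + 0 ℤ.< + suc x * i → + 0 ℤ.< i
0<[1+x]*i⇒0<i x {i} pos = ℤP.*-cancelˡ-<-nonNeg (+ suc x) (subst (ℤ._< + suc x * i) (sym (ℤP.*-zeroʳ (+ suc x))) pos)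

0<j-i⇒i<j : ∀ {i j} → + 0 ℤ.< j - i → i ℤ.< j
0<j-i⇒i<j {i} {j} 0<j-i = subst₂ ℤ._<_ (ℤP.+-identityˡ i) (ring j i) (ℤP.+-monoˡ-< i 0<j-i)
  where
  ring : ∀ j i → j - i + i ≡ j
  ring = solve-∀

0<i⇒j-i<j : ∀ {i} j → + 0 ℤ.< i → j - i ℤ.< j
0<i⇒j-i<j j 0<i = subst (j - _ ℤ.<_) (ℤP.+-identityʳ j) (ℤP.+-monoʳ-< j (ℤP.neg-mono-< 0<i))

remainders-unique : ∀ {r s m} (q p : ℤ) → r < m → s < m → + r + q * + m ≡ + s + p * + m → r ≡ s
remainders-unique {r} {s} {m} q p r<m s<m eq =
  ℤP.+-injective (ℤP.i-j≡0⇒i≡j (+ r) (+ s) (ℤP.∣i∣≡0⇒i≡0 ∣r-s∣≡0))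
  where
  r-s≡[p-q]m : + r - + s ≡ (p - q) * + m
  r-s≡[p-q]m = begin
    + r - + s                       ≡⟨ ring₁ (+ r) (+ s) q (+ m) ⟩
    (+ r + q * + m) - + s - q * + m ≡⟨ cong (λ u → u - + s - q * + m) eq ⟩
    (+ s + p * + m) - + s - q * + m ≡⟨ ring₂ (+ s) q p (+ m) ⟩
    (p - q) * + m                   ∎
    where
    open ≡-Reasoning
    ring₁ : ∀ r s q m → r - s ≡ (r + q * m) - s - q * m
    ring₁ = solve-∀
    ring₂ : ∀ s q p m → (s + p * m) - s - q * m ≡ (p - q) * m
    ring₂ = solve-∀
  ∣r-s∣<m : ∣ + r - + s ∣ < m
  ∣r-s∣<m = subst (_< m) (cong ∣_∣ (sym (ℤP.[+m]-[+n]≡m⊖n r s)))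
                  (ℕP.≤-<-trans (ℤP.∣m⊝n∣≤m⊔n r s) (ℕP.⊔-lub r<m s<m))
  ∣r-s∣≡0 : ∣ + r - + s ∣ ≡ 0
  ∣r-s∣≡0 with ∣ p - q ∣ | trans (cong ∣_∣ r-s≡[p-q]m) (ℤP.abs-* (p - q) (+ m))
  ... | zero  | ∣r-s∣≡0 = ∣r-s∣≡0
  ... | suc k | ∣r-s∣≡m+km = contradiction (subst (_< m) ∣r-s∣≡m+km ∣r-s∣<m) (ℕP.≤⇒≯ (ℕP.m≤m+n m (k ℕ.* m)))

modZ-unique : ∀ {y M r} q → + 0 ℤ.≤ r → r ℤ.< M → y ≡ r + q * M → modZ y M ≡ r
modZ-unique {y} {+[1+ k ]} {+ r} q _ (+<+ r<M) y≡r+qM =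
  cong +_ (remainders-unique (y ℤ./ℕ suc k) q (ℤD.n%ℕd<d y (suc k)) r<M
                             (trans (sym (ℤD.a≡a%ℕn+[a/ℕn]*n y (suc k))) y≡r+qM))
modZ-unique {M = + zero}   {+ r} q _ (+<+ ()) _
modZ-unique {M = -[1+ k ]} {+ r} q _ ()       _

[1+k]s/[1+k]≡s/1 : ∀ k s → + (suc k ℕ.* s) ℚ./ suc k ≡ + s ℚ./ 1
[1+k]s/[1+k]≡s/1 k s = ℚP.fromℚᵘ-cong {ℚᵘ.mkℚᵘ (+ (suc k ℕ.* s)) k} {ℚᵘ.mkℚᵘ (+ s) 0} (*≡* (begin
  + (suc k ℕ.* s) * + 1 ≡⟨ ℤP.*-identityʳ _ ⟩
  + (suc k ℕ.* s)       ≡⟨ ℤP.pos-* (suc k) s ⟩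
  + suc k * + s         ≡⟨ ℤP.*-comm (+ suc k) (+ s) ⟩
  + s * + suc k         ∎))
  where open ≡-Reasoning

s/1≡-1+[1+s]/1 : ∀ s → + s ℚ./ 1 ≡ -[1+ 0 ] ℚ./ 1 ℚ.+ + suc s ℚ./ 1
s/1≡-1+[1+s]/1 s = ℚP.toℚᵘ-injective (begin
  ℚ.toℚᵘ (+ s ℚ./ 1)                                     ≈⟨ ℚP.toℚᵘ-fromℚᵘ (ℚᵘ.mkℚᵘ (+ s) 0) ⟩
  ℚᵘ.mkℚᵘ (+ s) 0                                         ≈⟨ *≡* (ring (+ s)) ⟩
  ℚᵘ.mkℚᵘ -[1+ 0 ] 0 ℚᵘ.+ ℚᵘ.mkℚᵘ (+ suc s) 0             ≈⟨ ℚᵘP.+-cong (ℚP.toℚᵘ-fromℚᵘ (ℚᵘ.mkℚᵘ -[1+ 0 ] 0)) (ℚP.toℚᵘ-fromℚᵘ (ℚᵘ.mkℚᵘ (+ suc s) 0)) ⟨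
  ℚ.toℚᵘ (-[1+ 0 ] ℚ./ 1) ℚᵘ.+ ℚ.toℚᵘ (+ suc s ℚ./ 1)     ≈⟨ ℚP.toℚᵘ-homo-+ (-[1+ 0 ] ℚ./ 1) (+ suc s ℚ./ 1) ⟨
  ℚ.toℚᵘ (-[1+ 0 ] ℚ./ 1 ℚ.+ + suc s ℚ./ 1)               ∎)
  where
  open ℚᵘP.≃-Reasoning
  ring : ∀ t → t * + 1 ≡ (-[1+ 0 ] * + 1 + (+ 1 + t) * + 1) * + 1
  ring = solve-∀

recoveryFormula : (α B N x : ℤ) → ℚ
recoveryFormula α B N x = qdiv (- + 1 - sgn α) (+ 2) ℚ.+ qdiv (modZ (modZ (- sgn α * N) B) x) (+ ∣ α ∣)

module Recovery
  (Y τ : ℕ) (α B B' N N' P P' R : ℤ)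
  (B≡ : B ≡ + suc Y * B' + α) (N≡ : N ≡ + suc Y * N') (P≡ : P ≡ + suc Y * P' + + τ)
  (division : N ≡ B * P + R) (0<R : + 0 ℤ.< R) (R<B : R ℤ.< B)
  where

  x q : ℤ
  x = + suc Y
  q = N' - B' * P - α * P'

  R≡-ατ+qx : R ≡ - α * + τ + q * x
  R≡-ατ+qx = begin
    R                                       ≡⟨ ring₁ R (B * P) ⟩
    (B * P + R) - B * P                     ≡⟨ cong (λ u → u - B * P) division ⟨
    N - B * P                               ≡⟨ cong₂ (λ u v → u - v * P) N≡ B≡ ⟩
    x * N' - (x * B' + α) * P               ≡⟨ ring₂ x N' B' α P ⟩
    (N' - B' * P) * x - α * P               ≡⟨ cong (λ u → (N' - B' * P) * x - α * u) P≡ ⟩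
    (N' - B' * P) * x - α * (x * P' + + τ)  ≡⟨ ring₃ x N' B' α P P' (+ τ) ⟩
    - α * + τ + q * x                       ∎
    where
    open ≡-Reasoning
    ring₁ : ∀ r c → r ≡ (c + r) - c
    ring₁ = solve-∀
    ring₂ : ∀ x N B α P → x * N - (x * B + α) * P ≡ (N - B * P) * x - α * P
    ring₂ = solve-∀
    ring₃ : ∀ x N B α P P' t → (N - B * P) * x - α * (x * P' + t) ≡ - α * t + (N - B * P - α * P') * x
    ring₃ = solve-∀

  residue-of-N : ∀ k → α ≡ -[1+ k ] → suc k ℕ.* τ < suc Y → modZ (modZ (+ 1 * N) B) x ≡ + (suc k ℕ.* τ)
  residue-of-N k α≡ small = begin
    modZ (modZ (+ 1 * N) B) x  ≡⟨ cong (λ u → modZ u x) (modZ-unique P (ℤP.<⇒≤ 0<R) R<B N≡R+PB) ⟩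
    modZ R x                   ≡⟨ modZ-unique q (+≤+ z≤n) (+<+ small) R≡ ⟩
    + (suc k ℕ.* τ)            ∎
    where
    open ≡-Reasoning
    ring : ∀ B P R → + 1 * (B * P + R) ≡ R + P * B
    ring = solve-∀
    N≡R+PB : + 1 * N ≡ R + P * B
    N≡R+PB = trans (cong (+ 1 *_) division) (ring B P R)
    R≡ : R ≡ + (suc k ℕ.* τ) + q * x
    R≡ = trans R≡-ατ+qx (cong (_+ q * x) (trans (cong (λ a → - a * + τ) α≡) (sym (ℤP.pos-* (suc k) τ))))

  residue-of-negated-N : ∀ k → α ≡ +[1+ k ] → suc k ℕ.* suc τ < suc Y →
                         modZ (modZ (- + 1 * N) B) x ≡ + (suc k ℕ.* suc τ)
  residue-of-negated-N k α≡ small = begin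
    modZ (modZ (- + 1 * N) B) x  ≡⟨ cong (λ u → modZ u x) (modZ-unique (- P - + 1) (ℤP.i≤j⇒0≤j-i (ℤP.<⇒≤ R<B)) (0<i⇒j-i<j B 0<R) -N≡) ⟩
    modZ (B - R) x               ≡⟨ modZ-unique (B' - q) (+≤+ z≤n) (+<+ small) B-R≡ ⟩
    + (suc k ℕ.* suc τ)          ∎
    where
    open ≡-Reasoning
    ring₁ : ∀ B P R → - + 1 * (B * P + R) ≡ (B - R) + (- P - + 1) * B
    ring₁ = solve-∀
    -N≡ : - + 1 * N ≡ (B - R) + (- P - + 1) * B
    -N≡ = trans (cong (- + 1 *_) division) (ring₁ B P R)
    ring₂ : ∀ x B α t q → (x * B + α) - (- α * t + q * x) ≡ α * (+ 1 + t) + (B - q) * x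
    ring₂ = solve-∀
    B-R≡ : B - R ≡ + (suc k ℕ.* suc τ) + (B' - q) * x
    B-R≡ = begin
      B - R                                   ≡⟨ cong₂ _-_ B≡ R≡-ατ+qx ⟩
      (x * B' + α) - (- α * + τ + q * x)      ≡⟨ ring₂ x B' α (+ τ) q ⟩
      α * + suc τ + (B' - q) * x              ≡⟨ cong (λ a → a * + suc τ + (B' - q) * x) α≡ ⟩
      + suc k * + suc τ + (B' - q) * x        ≡⟨ cong (_+ (B' - q) * x) (ℤP.pos-* (suc k) (suc τ)) ⟨
      + (suc k ℕ.* suc τ) + (B' - q) * x      ∎

  t-recovered : α ≢ + 0 → ∣ α ∣ ℕ.* suc τ < suc Y → + τ ℚ./ 1 ≡ recoveryFormula α B N x
  t-recovered = by-sign α refl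
    where
    open ≡-Reasoning
    by-sign : ∀ a → α ≡ a → a ≢ + 0 → ∣ a ∣ ℕ.* suc τ < suc Y → + τ ℚ./ 1 ≡ recoveryFormula a B N x
    by-sign (+ zero)   _  a≢0 _     = contradiction refl a≢0
    by-sign +[1+ k ] α≡ _   small = begin
      + τ ℚ./ 1                                         ≡⟨ s/1≡-1+[1+s]/1 τ ⟩
      -[1+ 0 ] ℚ./ 1 ℚ.+ + suc τ ℚ./ 1                  ≡⟨ cong (-[1+ 0 ] ℚ./ 1 ℚ.+_) ([1+k]s/[1+k]≡s/1 k (suc τ)) ⟨
      -[1+ 0 ] ℚ./ 1 ℚ.+ + (suc k ℕ.* suc τ) ℚ./ suc k  ≡⟨ cong (λ r → -[1+ 0 ] ℚ./ 1 ℚ.+ qdiv r (+ suc k)) (residue-of-negated-N k α≡ small) ⟨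
      recoveryFormula +[1+ k ] B N x                    ∎
    by-sign -[1+ k ] α≡ _   small = begin
      + τ ℚ./ 1                                         ≡⟨ ℚP.+-identityˡ _ ⟨
      ℚ.0ℚ ℚ.+ + τ ℚ./ 1                                ≡⟨ cong (ℚ.0ℚ ℚ.+_) ([1+k]s/[1+k]≡s/1 k τ) ⟨
      ℚ.0ℚ ℚ.+ + (suc k ℕ.* τ) ℚ./ suc k                ≡⟨ cong (λ r → ℚ.0ℚ ℚ.+ qdiv r (+ suc k)) (residue-of-N k α≡ small′) ⟨
      recoveryFormula -[1+ k ] B N x                    ∎
      where
      small′ : suc k ℕ.* τ < suc Y
      small′ = ℕP.≤-<-trans (ℕP.*-monoʳ-≤ (suc k) (ℕP.n≤1+n τ)) small

module LinearRecurrence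
  (d' : ℕ) (b A : ℕ → ℤ) (t : ℕ → ℕ)
  (b₀≡1 : b 0 ≡ + 1)
  (b-vanishes : ∀ i → suc d' < i → b i ≡ + 0)
  (A-vanishes : ∀ i → suc d' ≤ i → A i ≡ + 0)
  (recurrence : ∀ n → sumTo n (λ i → b i * + t (n ∸ i)) ≡ A n)
  where

  d : ℕ
  d = suc d'

  T : ℕ → ℤ
  T i = + t i

  -- rem m (1 + j) is the coefficient of z^(m+1+j) in B(z) · Σ_{i>m} t(i) zⁱ.
  rem : ℕ → ℕ → ℤ
  rem m zero    = + 0
  rem m (suc j) = sumTo j (λ i → b i * T (m ℕ.+ suc j ∸ i))

  T₀≡A₀ : T 0 ≡ A 0
  T₀≡A₀ = trans (sym (trans (cong (_* T 0) b₀≡1) (ℤP.*-identityˡ (T 0)))) (recurrence 0)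

  rem-one : ∀ m → rem m 1 ≡ T (suc m)
  rem-one m = trans (cong (_* T (m ℕ.+ 1)) b₀≡1) (trans (ℤP.*-identityˡ _) (cong T (ℕP.+-comm m 1)))

  rem-shift : ∀ m j → rem m (2 ℕ.+ j) ≡ rem (suc m) (suc j) + b (suc j) * T (suc m)
  rem-shift m j = cong₂ _+_
    (sumTo-cong j (λ i → cong (λ n → b i * T (n ∸ i)) (ℕP.+-suc m (suc j))))
    (cong (λ n → b (suc j) * T n) (trans (cong (_∸ suc j) (ℕP.+-suc m (suc j))) (ℕP.m+n∸n≡m (suc m) (suc j))))

  rem-initial : ∀ j → rem 0 (suc j) + b (suc j) * T 0 ≡ A (suc j)
  rem-initial j = trans (cong (λ n → rem 0 (suc j) + b (suc j) * T n) (sym (ℕP.n∸n≡0 j))) (recurrence (suc j))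

  rem-vanishes : ∀ m {j} → d ≤ j → rem m (suc j) ≡ + 0
  rem-vanishes m {j} d≤j = begin
    rem m (suc j)          ≡⟨ sumTo-+-zeros j (suc m) b-beyond ⟨
    sumTo (j ℕ.+ suc m) f  ≡⟨ cong (λ k → sumTo k f) (ring j m) ⟩
    sumTo (m ℕ.+ suc j) f  ≡⟨ recurrence (m ℕ.+ suc j) ⟩
    A (m ℕ.+ suc j)        ≡⟨ A-vanishes _ (ℕP.≤-trans d≤j (ℕP.≤-trans (ℕP.n≤1+n j) (ℕP.m≤n+m (suc j) m))) ⟩
    + 0                    ∎
    where
    open ≡-Reasoning
    f : ℕ → ℤ
    f i = b i * T (m ℕ.+ suc j ∸ i)
    b-beyond : ∀ i → j < i → f i ≡ + 0
    b-beyond i j<i = trans (cong (_* T (m ℕ.+ suc j ∸ i)) (b-vanishes i (ℕP.≤-<-trans d≤j j<i))) (ℤP.*-zeroˡ (T (m ℕ.+ suc j ∸ i)))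
    ring : ∀ j m → j ℕ.+ suc m ≡ m ℕ.+ suc j
    ring = ℕSolver.solve-∀

  module AtPoint (x : ℤ) where

    B̃ Ã : ℤ
    B̃ = revEval b x d
    Ã = revEval A x d

    remainder : ℕ → ℤ
    remainder m = revEval (rem m) x d

    quotient : ℕ → ℤ
    quotient zero    = T 0
    quotient (suc m) = x * quotient m + T (suc m)

    revEval-rem-step : ∀ m k → x * revEval (rem m) x k + rem m (suc k) ≡
                               revEval b x k * T (suc m) + revEval (rem (suc m)) x k
    revEval-rem-step m zero = begin
      x * + 0 + rem m 1       ≡⟨ cong (_+_ (x * + 0)) (rem-one m) ⟩
      x * + 0 + T (suc m)     ≡⟨ ring x (T (suc m)) ⟩
      + 1 * T (suc m) + + 0   ≡⟨ cong (λ c → c * T (suc m) + + 0) b₀≡1 ⟨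
      b 0 * T (suc m) + + 0   ∎
      where
      open ≡-Reasoning
      ring : ∀ x t → x * + 0 + t ≡ + 1 * t + + 0
      ring = solve-∀
    revEval-rem-step m (suc k) = begin
      x * (x * Q + rem m (suc k)) + rem m (2 ℕ.+ k)
        ≡⟨ cong₂ (λ u v → x * u + v) (revEval-rem-step m k) (rem-shift m k) ⟩
      x * (Bₖ * T (suc m) + Q') + (rem (suc m) (suc k) + b (suc k) * T (suc m))
        ≡⟨ ring x Bₖ (T (suc m)) Q' (rem (suc m) (suc k)) (b (suc k)) ⟩
      (x * Bₖ + b (suc k)) * T (suc m) + (x * Q' + rem (suc m) (suc k))
        ∎
      where
      open ≡-Reasoning
      Q Q' Bₖ : ℤ
      Q  = revEval (rem m) x k
      Q' = revEval (rem (suc m)) x k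
      Bₖ = revEval b x k
      ring : ∀ x B t Q r c → x * (B * t + Q) + (r + c * t) ≡ (x * B + c) * t + (x * Q + r)
      ring = solve-∀

    remainder-step : ∀ m → x * remainder m ≡ B̃ * T (suc m) + remainder (suc m)
    remainder-step m = begin
      x * remainder m                       ≡⟨ ℤP.+-identityʳ _ ⟨
      x * remainder m + + 0                 ≡⟨ cong (_+_ (x * remainder m)) (rem-vanishes m ℕP.≤-refl) ⟨
      x * remainder m + rem m (suc d)       ≡⟨ revEval-rem-step m d ⟩
      B̃ * T (suc m) + remainder (suc m)    ∎
      where open ≡-Reasoning

    revEval-initial : ∀ k → revEval A x k ≡ revEval b x k * T 0 + revEval (rem 0) x k
    revEval-initial zero = begin
      A 0                 ≡⟨ T₀≡A₀ ⟨
      T 0                 ≡⟨ ring (T 0) ⟩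
      + 1 * T 0 + + 0     ≡⟨ cong (λ c → c * T 0 + + 0) b₀≡1 ⟨
      b 0 * T 0 + + 0     ∎
      where
      open ≡-Reasoning
      ring : ∀ t → t ≡ + 1 * t + + 0
      ring = solve-∀
    revEval-initial (suc k) = begin
      x * revEval A x k + A (suc k)
        ≡⟨ cong₂ (λ u v → x * u + v) (revEval-initial k) (sym (rem-initial k)) ⟩
      x * (Bₖ * T 0 + Q) + (rem 0 (suc k) + b (suc k) * T 0)
        ≡⟨ ring x Bₖ (T 0) Q (rem 0 (suc k)) (b (suc k)) ⟩
      (x * Bₖ + b (suc k)) * T 0 + (x * Q + rem 0 (suc k))
        ∎
      where
      open ≡-Reasoning
      Q Bₖ : ℤ
      Q  = revEval (rem 0) x k
      Bₖ = revEval b x k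
      ring : ∀ x B t Q r c → x * (B * t + Q) + (r + c * t) ≡ (x * B + c) * t + (x * Q + r)
      ring = solve-∀

    division-identity : ∀ m → x ^ m * Ã ≡ B̃ * quotient m + remainder m
    division-identity zero    = trans (ℤP.*-identityˡ Ã) (revEval-initial d)
    division-identity (suc m) = begin
      x * x ^ m * Ã                                   ≡⟨ ℤP.*-assoc x (x ^ m) Ã ⟩
      x * (x ^ m * Ã)                                 ≡⟨ cong (x *_) (division-identity m) ⟩
      x * (B̃ * quotient m + remainder m)              ≡⟨ ℤP.*-distribˡ-+ x _ (remainder m) ⟩
      x * (B̃ * quotient m) + x * remainder m          ≡⟨ cong (_+_ (x * (B̃ * quotient m))) (remainder-step m) ⟩
      x * (B̃ * quotient m) + (B̃ * T (suc m) + remainder (suc m))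
                                                      ≡⟨ ring x B̃ (quotient m) (T (suc m)) (remainder (suc m)) ⟩
      B̃ * quotient (suc m) + remainder (suc m)        ∎
      where
      open ≡-Reasoning
      ring : ∀ x B p t q → x * (B * p) + (B * t + q) ≡ B * (x * p + t) + q
      ring = solve-∀

  module Nonvanishing (A₀>0 : + 0 ℤ.< A 0) (b-top≢0 : b d ≢ + 0) where

    RemVanishes : ℕ → Set
    RemVanishes m = ∀ j → rem m (suc j) ≡ + 0

    b-top*s≡0⇒s≡0 : ∀ {s} → b d * s ≡ + 0 → s ≡ + 0
    b-top*s≡0⇒s≡0 eq with ℤP.i*j≡0⇒i≡0∨j≡0 (b d) eq
    ... | inj₁ b-top≡0 = contradiction b-top≡0 b-top≢0
    ... | inj₂ s≡0     = s≡0

    RemVanishes-pred : ∀ m → RemVanishes (suc m) → RemVanishes m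
    RemVanishes-pred m vanishes zero    = trans (rem-one m) T≡0
      where
      T≡0 : T (suc m) ≡ + 0
      T≡0 = b-top*s≡0⇒s≡0 (begin
        b d * T (suc m)                  ≡⟨ ℤP.+-identityˡ _ ⟨
        + 0 + b d * T (suc m)            ≡⟨ cong (_+ b d * T (suc m)) (vanishes d') ⟨
        rem (suc m) d + b d * T (suc m)  ≡⟨ rem-shift m d' ⟨
        rem m (suc d)                    ≡⟨ rem-vanishes m ℕP.≤-refl ⟩
        + 0                              ∎)
        where open ≡-Reasoning
    RemVanishes-pred m vanishes (suc j) = begin
      rem m (2 ℕ.+ j)                              ≡⟨ rem-shift m j ⟩
      rem (suc m) (suc j) + b (suc j) * T (suc m)  ≡⟨ cong₂ (λ u v → u + b (suc j) * v) (vanishes j) (sym (rem-one m)) ⟩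
      + 0 + b (suc j) * rem m 1                    ≡⟨ cong (λ v → + 0 + b (suc j) * v) (RemVanishes-pred m vanishes zero) ⟩
      + 0 + b (suc j) * + 0                        ≡⟨ ring (b (suc j)) ⟩
      + 0                                          ∎
      where
      open ≡-Reasoning
      ring : ∀ c → + 0 + c * + 0 ≡ + 0
      ring = solve-∀

    ¬RemVanishes : ∀ m → ¬ RemVanishes m
    ¬RemVanishes (suc m) = ¬RemVanishes m ∘ RemVanishes-pred m
    ¬RemVanishes zero vanishes = ℤP.<⇒≢ A₀>0 (sym (trans (sym T₀≡A₀) T₀≡0))
      where
      open ≡-Reasoning
      T₀≡0 : T 0 ≡ + 0
      T₀≡0 = b-top*s≡0⇒s≡0 (begin
        b d * T 0                  ≡⟨ ℤP.+-identityˡ _ ⟨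
        + 0 + b d * T 0            ≡⟨ cong (_+ b d * T 0) (vanishes d') ⟨
        rem 0 d + b d * T 0        ≡⟨ rem-initial d' ⟩
        A d                        ≡⟨ A-vanishes d ℕP.≤-refl ⟩
        + 0                        ∎)

    rem-window : ∀ m → ∃ λ j → j < d × rem m (suc j) ≢ + 0
    rem-window m with ℕP.anyUpTo? (λ j → ¬? (rem m (suc j) ℤP.≟ + 0)) d
    ... | yes found = found
    ... | no  none  = contradiction vanishes (¬RemVanishes m)
      where
      vanishes : RemVanishes m
      vanishes j with j ℕP.<? d
      ... | yes j<d = decidable-stable (rem m (suc j) ℤP.≟ + 0) (λ rem≢0 → none (j , j<d , rem≢0))
      ... | no  j≮d = rem-vanishes m (ℕP.≮⇒≥ j≮d)

  module Growth (β γ : ℕ) (∣b∣≤β : ∀ i → ∣ b i ∣ ≤ β) (∣A∣≤γ : ∀ i → ∣ A i ∣ ≤ γ) where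

    K H : ℕ
    K = γ ℕ.+ β ℕ.* t 0
    H = suc β

    ∣rem∣≤KHᵐ : ∀ m j → ∣ rem m (suc j) ∣ ≤ K ℕ.* H ℕ.^ m
    ∣rem∣≤KHᵐ zero j = begin
      ∣ rem 0 (suc j) ∣                        ≡⟨ cong ∣_∣ (ring (rem 0 (suc j)) (b (suc j) * T 0)) ⟩
      ∣ rem 0 (suc j) + bT - bT ∣              ≡⟨ cong (λ u → ∣ u - bT ∣) (rem-initial j) ⟩
      ∣ A (suc j) - bT ∣                       ≤⟨ ℤP.∣i-j∣≤∣i∣+∣j∣ (A (suc j)) bT ⟩
      ∣ A (suc j) ∣ ℕ.+ ∣ bT ∣                 ≡⟨ cong (∣ A (suc j) ∣ ℕ.+_) (ℤP.abs-* (b (suc j)) (T 0)) ⟩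
      ∣ A (suc j) ∣ ℕ.+ ∣ b (suc j) ∣ ℕ.* t 0  ≤⟨ ℕP.+-mono-≤ (∣A∣≤γ (suc j)) (ℕP.*-monoˡ-≤ (t 0) (∣b∣≤β (suc j))) ⟩
      K                                        ≡⟨ ℕP.*-identityʳ K ⟨
      K ℕ.* 1                                  ∎
      where
      open ℕP.≤-Reasoning
      bT = b (suc j) * T 0
      ring : ∀ r c → r ≡ r + c - c
      ring = solve-∀
    ∣rem∣≤KHᵐ (suc m) j = begin
      ∣ rem (suc m) (suc j) ∣                            ≡⟨ cong ∣_∣ rem≡ ⟩
      ∣ rem m (2 ℕ.+ j) - b (suc j) * rem m 1 ∣          ≤⟨ ℤP.∣i-j∣≤∣i∣+∣j∣ (rem m (2 ℕ.+ j)) (b (suc j) * rem m 1) ⟩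
      ∣ rem m (2 ℕ.+ j) ∣ ℕ.+ ∣ b (suc j) * rem m 1 ∣    ≡⟨ cong (∣ rem m (2 ℕ.+ j) ∣ ℕ.+_) (ℤP.abs-* (b (suc j)) (rem m 1)) ⟩
      ∣ rem m (2 ℕ.+ j) ∣ ℕ.+ ∣ b (suc j) ∣ ℕ.* ∣ rem m 1 ∣
                                                         ≤⟨ ℕP.+-mono-≤ (∣rem∣≤KHᵐ m (suc j)) (ℕP.*-mono-≤ (∣b∣≤β (suc j)) (∣rem∣≤KHᵐ m 0)) ⟩
      K ℕ.* H ℕ.^ m ℕ.+ β ℕ.* (K ℕ.* H ℕ.^ m)            ≡⟨ ring K β (H ℕ.^ m) ⟩
      K ℕ.* H ℕ.^ suc m                                  ∎
      where
      open ℕP.≤-Reasoning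
      rem≡ : rem (suc m) (suc j) ≡ rem m (2 ℕ.+ j) - b (suc j) * rem m 1
      rem≡ = trans (ringℤ (rem (suc m) (suc j)) (b (suc j) * T (suc m)))
                   (sym (cong₂ (λ u v → u - b (suc j) * v) (rem-shift m j) (rem-one m)))
        where
        ringℤ : ∀ r c → r ≡ r + c - c
        ringℤ = solve-∀
      ring : ∀ K β h → K ℕ.* h ℕ.+ β ℕ.* (K ℕ.* h) ≡ K ℕ.* ((1 ℕ.+ β) ℕ.* h)
      ring = ℕSolver.solve-∀

    t≤KHᵐ : ∀ m → t (suc m) ≤ K ℕ.* H ℕ.^ m
    t≤KHᵐ m = subst (_≤ K ℕ.* H ℕ.^ m) (cong ∣_∣ (rem-one m)) (∣rem∣≤KHᵐ m 0)

    module LargePoint (A₀>0 : + 0 ℤ.< A 0) (b-top≢0 : b d ≢ + 0)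
                      (n' Y : ℕ) (large : H ℕ.* (β ℕ.+ K ℕ.* H ℕ.^ (suc n' ℕ.+ d)) ≤ Y) where

      open Nonvanishing A₀>0 b-top≢0

      n X : ℕ
      n = suc n'
      X = suc Y

      x : ℤ
      x = + X

      open AtPoint x public

      coeff-scale≤Y : ∀ m → m ≤ n ℕ.+ d → β ℕ.+ K ℕ.* H ℕ.^ m ≤ Y
      coeff-scale≤Y m m≤n+d = ℕP.≤-trans (ℕP.+-monoʳ-≤ β (ℕP.*-monoʳ-≤ K (ℕP.^-monoʳ-≤ H m≤n+d)))
                                          (ℕP.≤-trans (ℕP.m≤n*m _ H) large)

      ∣B̃-Xᵈ∣≤ : ∣ B̃ - + (X ℕ.^ d) ∣ ≤ β ℕ.* powSum X d
      ∣B̃-Xᵈ∣≤ = subst (λ z → ∣ B̃ - z ∣ ≤ β ℕ.* powSum X d) b₀Xᵈ≡Xᵈ (revEval-tail-bound b X β d (∣b∣≤β ∘ suc))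
        where
        b₀Xᵈ≡Xᵈ : b 0 * x ^ d ≡ + (X ℕ.^ d)
        b₀Xᵈ≡Xᵈ = trans (cong (_* x ^ d) b₀≡1) (trans (ℤP.*-identityˡ (x ^ d)) (pos-^ X d))

      ∣remainder∣≤ : ∀ m → ∣ remainder m ∣ ≤ K ℕ.* H ℕ.^ m ℕ.* powSum X d
      ∣remainder∣≤ m = subst (λ z → ∣ z ∣ ≤ K ℕ.* H ℕ.^ m ℕ.* powSum X d) (ring (remainder m) (x ^ d))
                             (revEval-tail-bound (rem m) X (K ℕ.* H ℕ.^ m) d (∣rem∣≤KHᵐ m))
        where
        ring : ∀ q y → q - + 0 * y ≡ q
        ring = solve-∀

      ∣B̃-Xᵈ∣+∣remainder∣<Xᵈ : ∀ m → m ≤ n ℕ.+ d → ∣ B̃ - + (X ℕ.^ d) ∣ ℕ.+ ∣ remainder m ∣ < X ℕ.^ d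
      ∣B̃-Xᵈ∣+∣remainder∣<Xᵈ m m≤n+d = begin-strict
        ∣ B̃ - + (X ℕ.^ d) ∣ ℕ.+ ∣ remainder m ∣       ≤⟨ ℕP.+-mono-≤ ∣B̃-Xᵈ∣≤ (∣remainder∣≤ m) ⟩
        β ℕ.* S ℕ.+ K ℕ.* H ℕ.^ m ℕ.* S              ≡⟨ ℕP.*-distribʳ-+ S β (K ℕ.* H ℕ.^ m) ⟨
        (β ℕ.+ K ℕ.* H ℕ.^ m) ℕ.* S                  ≤⟨ ℕP.*-monoˡ-≤ S (coeff-scale≤Y m m≤n+d) ⟩
        Y ℕ.* S                                      <⟨ ℕP.n<1+n (Y ℕ.* S) ⟩
        suc (Y ℕ.* S)                                ≡⟨ ℕP.+-comm 1 (Y ℕ.* S) ⟩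
        Y ℕ.* S ℕ.+ 1                                ≡⟨ [1+y]^k≡y*powSum+1 Y d ⟨
        X ℕ.^ d                                      ∎
        where
        open ℕP.≤-Reasoning
        S = powSum X d

      0<B̃+u : ∀ m u → m ≤ n ℕ.+ d → ∣ u ∣ ≤ ∣ remainder m ∣ → + 0 ℤ.< B̃ + u
      0<B̃+u m u m≤n+d ∣u∣≤ = subst (+ 0 ℤ.<_) (ring B̃ (+ (X ℕ.^ d)) u)
        (0<n+i+j (B̃ - + (X ℕ.^ d)) u (ℕP.≤-<-trans (ℕP.+-monoʳ-≤ _ ∣u∣≤) (∣B̃-Xᵈ∣+∣remainder∣<Xᵈ m m≤n+d)))
        where
        ring : ∀ B p u → p + (B - p) + u ≡ B + u
        ring = solve-∀

      0<B̃ : + 0 ℤ.< B̃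
      0<B̃ = subst (+ 0 ℤ.<_) (ℤP.+-identityʳ B̃) (0<B̃+u 0 (+ 0) z≤n z≤n)

      remainder<B̃ : remainder n ℤ.< B̃
      remainder<B̃ = 0<j-i⇒i<j (0<B̃+u n (- remainder n) (ℕP.m≤m+n n d) (ℕP.≤-reflexive (ℤP.∣-i∣≡∣i∣ (remainder n))))

      0<remainder-if-t>0 : ∀ m s → suc m ≤ n ℕ.+ d → t (suc m) ≡ suc s → + 0 ℤ.< remainder m
      0<remainder-if-t>0 m s m<n+d t≡ = 0<[1+x]*i⇒0<i Y (subst (+ 0 ℤ.<_) (sym x*Q≡) 0<rhs)
        where
        ring : ∀ B q s → B * (+ 1 + s) + q ≡ (B + q) + B * s
        ring = solve-∀
        x*Q≡ : x * remainder m ≡ (B̃ + remainder (suc m)) + B̃ * + s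
        x*Q≡ = trans (remainder-step m) (trans (cong (λ k → B̃ * + k + remainder (suc m)) t≡) (ring B̃ (remainder (suc m)) (+ s)))
        0<rhs : + 0 ℤ.< (B̃ + remainder (suc m)) + B̃ * + s
        0<rhs = ℤP.+-mono-<-≤ (0<B̃+u (suc m) (remainder (suc m)) m<n+d ℕP.≤-refl)
                              (subst (ℤ._≤ B̃ * + s) (ℤP.*-zeroˡ (+ s)) (ℤP.*-monoʳ-≤-nonNeg (+ s) (ℤP.<⇒≤ 0<B̃)))

      0<remainder-from : ∀ j m → m ℕ.+ suc j ≤ n ℕ.+ d → rem m (suc j) ≢ + 0 → + 0 ℤ.< remainder m
      0<remainder-from j m m+1+j≤ rem≢0 with t (suc m) in t≡
      ... | suc s = 0<remainder-if-t>0 m s (ℕP.≤-trans 1+m≤m+1+j m+1+j≤) t≡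
        where
        1+m≤m+1+j : suc m ≤ m ℕ.+ suc j
        1+m≤m+1+j = subst (_≤ m ℕ.+ suc j) (ℕP.+-comm m 1) (ℕP.+-monoʳ-≤ m (s≤s z≤n))
      0<remainder-from zero    m _ rem≢0 | zero = contradiction (trans (rem-one m) (cong +_ t≡)) rem≢0
      0<remainder-from (suc j) m m+2+j≤ rem≢0 | zero = 0<[1+x]*i⇒0<i Y (subst (+ 0 ℤ.<_) (sym x*Q≡Q') IH)
        where
        ring : ∀ r c → r + c * + 0 ≡ r
        ring = solve-∀
        rem≡ : rem m (2 ℕ.+ j) ≡ rem (suc m) (suc j)
        rem≡ = trans (rem-shift m j) (trans (cong (λ k → rem (suc m) (suc j) + b (suc j) * + k) t≡) (ring _ (b (suc j))))
        x*Q≡Q' : x * remainder m ≡ remainder (suc m)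
        x*Q≡Q' = trans (remainder-step m) (trans (cong (λ k → B̃ * + k + remainder (suc m)) t≡)
                                                 (trans (cong (_+ remainder (suc m)) (ℤP.*-zeroʳ B̃)) (ℤP.+-identityˡ _)))
        IH : + 0 ℤ.< remainder (suc m)
        IH = 0<remainder-from j (suc m) (subst (_≤ n ℕ.+ d) (ℕP.+-suc m (suc j)) m+2+j≤) (rem≢0 ∘ trans rem≡)

      0<remainder : + 0 ℤ.< remainder n
      0<remainder with rem-window n
      ... | j , j<d , rem≢0 = 0<remainder-from j n (ℕP.+-monoʳ-≤ n j<d) rem≢0

      ∣b-top∣[1+tₙ]<X : ∣ b d ∣ ℕ.* suc (t n) < X
      ∣b-top∣[1+tₙ]<X = s≤s (begin
        ∣ b d ∣ ℕ.* suc (t n)           ≤⟨ ℕP.*-mono-≤ (∣b∣≤β d) (s≤s (ℕP.≤-trans (t≤KHᵐ n') (ℕP.*-monoʳ-≤ K (ℕP.^-monoʳ-≤ H n'≤n+d)))) ⟩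
        β ℕ.* suc w                      ≤⟨ ℕP.m≤m+n (β ℕ.* suc w) (w ℕ.+ β ℕ.* β) ⟩
        β ℕ.* suc w ℕ.+ (w ℕ.+ β ℕ.* β)  ≡⟨ ring β w ⟨
        H ℕ.* (β ℕ.+ w)                  ≤⟨ large ⟩
        Y                                ∎)
        where
        open ℕP.≤-Reasoning
        w = K ℕ.* H ℕ.^ (n ℕ.+ d)
        n'≤n+d : n' ≤ n ℕ.+ d
        n'≤n+d = ℕP.≤-trans (ℕP.n≤1+n n') (ℕP.m≤m+n n d)
        ring : ∀ β w → (1 ℕ.+ β) ℕ.* (β ℕ.+ w) ≡ β ℕ.* (1 ℕ.+ w) ℕ.+ (w ℕ.+ β ℕ.* β)
        ring = ℕSolver.solve-∀

      t-recovered : + t n ℚ./ 1 ≡ recoveryFormula (b d) B̃ (x ^ n * Ã) x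
      t-recovered = Recovery.t-recovered Y (t n) (b d) B̃ (revEval b x d') (x ^ n * Ã) (x ^ n' * Ã)
                      (quotient n) (quotient n') (remainder n) refl (ℤP.*-assoc x (x ^ n') Ã) refl
                      (division-identity n) 0<remainder remainder<B̃ b-top≢0 ∣b-top∣[1+tₙ]<X

1+z*hⁿ≤eⁿ : ∀ z {h e} n → h ≤ e → suc (z ℕ.* h) ≤ e → suc (z ℕ.* h ℕ.^ suc n) ≤ e ℕ.^ suc n
1+z*hⁿ≤eⁿ z {h} {e} zero    _   1+zh≤e =
  subst₂ _≤_ (cong (λ u → suc (z ℕ.* u)) (sym (ℕP.*-identityʳ h))) (sym (ℕP.*-identityʳ e)) 1+zh≤e
1+z*hⁿ≤eⁿ z {h} {e} (suc n) h≤e 1+zh≤e = begin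
  suc (z ℕ.* (h ℕ.* w))  ≡⟨ cong suc (ring z h w) ⟩
  suc (h ℕ.* (z ℕ.* w))  ≤⟨ ℕP.+-mono-≤ (ℕP.≤-trans (s≤s z≤n) 1+zh≤e) (ℕP.*-monoˡ-≤ (z ℕ.* w) h≤e) ⟩
  e ℕ.+ e ℕ.* (z ℕ.* w)  ≡⟨ ℕP.*-suc e (z ℕ.* w) ⟨
  e ℕ.* suc (z ℕ.* w)    ≤⟨ ℕP.*-monoʳ-≤ e (1+z*hⁿ≤eⁿ z n h≤e 1+zh≤e) ⟩
  e ℕ.* e ℕ.^ suc n      ∎
  where
  open ℕP.≤-Reasoning
  w = h ℕ.^ suc n
  ring : ∀ z h w → z ℕ.* (h ℕ.* w) ≡ h ℕ.* (z ℕ.* w)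
  ring = ℕSolver.solve-∀

module Corollary
  (d' : ℕ) (A a : Vec ℤ (suc d')) (t : ℕ → ℕ)
  (A₀>0 : + 0 ℤ.< coeff A 0) (b-top≢0 : coeff (Bpoly a) (suc d') ≢ + 0)
  (rec : ∀ n → cauchy (Bpoly a) t n ≡ coeff A n)
  where

  open LinearRecurrence d' (coeff (Bpoly a)) (coeff A) t refl (coeff-beyond (Bpoly a)) (coeff-beyond A) rec

  β γ : ℕ
  β = proj₁ (coeff-bounded (Bpoly a))
  γ = proj₁ (coeff-bounded A)

  open Growth β γ (proj₂ (coeff-bounded (Bpoly a))) (proj₂ (coeff-bounded A)) public

  Z : ℕ
  Z = H ℕ.* (β ℕ.+ K ℕ.* H ℕ.^ d)

  H[β+KHⁿ⁺ᵈ]≤ZHⁿ : ∀ n → H ℕ.* (β ℕ.+ K ℕ.* H ℕ.^ (n ℕ.+ d)) ≤ Z ℕ.* H ℕ.^ n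
  H[β+KHⁿ⁺ᵈ]≤ZHⁿ n = begin
    H ℕ.* (β ℕ.+ K ℕ.* H ℕ.^ (n ℕ.+ d))               ≡⟨ cong (λ h → H ℕ.* (β ℕ.+ K ℕ.* h)) (ℕP.^-distribˡ-+-* H n d) ⟩
    H ℕ.* (β ℕ.+ K ℕ.* (Hⁿ ℕ.* H ℕ.^ d))              ≤⟨ ℕP.*-monoʳ-≤ H (ℕP.+-monoˡ-≤ _ (ℕP.m≤m*n β Hⁿ {{ℕP.m^n≢0 H n}})) ⟩
    H ℕ.* (β ℕ.* Hⁿ ℕ.+ K ℕ.* (Hⁿ ℕ.* H ℕ.^ d))      ≡⟨ ring H β K Hⁿ (H ℕ.^ d) ⟩
    Z ℕ.* Hⁿ                                          ∎
    where
    open ℕP.≤-Reasoning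
    Hⁿ = H ℕ.^ n
    ring : ∀ H β K h g → H ℕ.* (β ℕ.* h ℕ.+ K ℕ.* (h ℕ.* g)) ≡ H ℕ.* (β ℕ.+ K ℕ.* g) ℕ.* h
    ring = ℕSolver.solve-∀

  Formula : ℕ → ℤ → ℤ → Set
  Formula n eⁿ eⁿⁿ =
    + t n ℚ./ 1 ≡ qdiv (- + 1 - sgn (alpha a)) (+ 2) ℚ.+
                  qdiv (modZ (modZ (- sgn (alpha a) * eⁿⁿ * eval (tildeA A) eⁿ) (eval (tildeB a) eⁿ)) eⁿ) (+ ∣ alpha a ∣)

  Conclusion : ℕ → ℤ → ℤ → Set
  Conclusion n eⁿ eⁿⁿ = (+ 0 ℤ.< eval (tildeB a) eⁿ) × Formula n eⁿ eⁿⁿ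

  conclusion : ∀ e n' → suc (Z ℕ.* H ℕ.^ suc n') ≤ e ℕ.^ suc n' →
               Conclusion (suc n') ((+ e) ^ suc n') ((+ e) ^ (suc n' ℕ.* suc n'))
  conclusion e n' 1+ZHⁿ≤eⁿ = subst₂ (Conclusion n) (sym eⁿ≡x) (sym eⁿⁿ≡xⁿ) (0<eval-tildeB , t-formula)
    where
    Y : ℕ
    Y = e ℕ.^ suc n' ∸ 1

    open LargePoint A₀>0 b-top≢0 n' Y (ℕP.≤-trans (H[β+KHⁿ⁺ᵈ]≤ZHⁿ (suc n')) (ℕP.∸-monoˡ-≤ 1 1+ZHⁿ≤eⁿ))

    eⁿ≡x : (+ e) ^ n ≡ x
    eⁿ≡x = trans (pos-^ e n) (cong +_ (sym (ℕP.m+[n∸m]≡n (ℕP.≤-trans (s≤s z≤n) 1+ZHⁿ≤eⁿ))))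

    eⁿⁿ≡xⁿ : (+ e) ^ (n ℕ.* n) ≡ x ^ n
    eⁿⁿ≡xⁿ = trans (sym (ℤP.^-*-assoc (+ e) n n)) (cong (_^ n) eⁿ≡x)

    eval-tildeB : eval (tildeB a) x ≡ B̃
    eval-tildeB = eval-reverse (Bpoly a) x

    eval-tildeA : eval (tildeA A) x ≡ Ã
    eval-tildeA = trans (eval-reverse (A ∷ʳ + 0) x) (revEval-cong x d (coeff-∷ʳ-+0 A))

    0<eval-tildeB : + 0 ℤ.< eval (tildeB a) x
    0<eval-tildeB = subst (+ 0 ℤ.<_) (sym eval-tildeB) 0<B̃

    t-formula : Formula n x (x ^ n)
    t-formula = begin
      + t n ℚ./ 1
        ≡⟨ t-recovered ⟩
      recoveryFormula (coeff (Bpoly a) d) B̃ (x ^ n * Ã) x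
        ≡⟨ cong₂ (λ α B → recoveryFormula α B (x ^ n * Ã) x) (coeff₀-reverse (Bpoly a)) eval-tildeB ⟨
      recoveryFormula (alpha a) (eval (tildeB a) x) (x ^ n * Ã) x
        ≡⟨ cong (λ Ã′ → recoveryFormula (alpha a) (eval (tildeB a) x) (x ^ n * Ã′) x) eval-tildeA ⟨
      recoveryFormula (alpha a) (eval (tildeB a) x) (x ^ n * eval (tildeA A) x) x
        ≡⟨ cong (λ N → qdiv (- + 1 - sgn (alpha a)) (+ 2) ℚ.+ qdiv (modZ (modZ N (eval (tildeB a) x)) x) (+ ∣ alpha a ∣))
                (ℤP.*-assoc (- sgn (alpha a)) (x ^ n) (eval (tildeA A) x)) ⟨
      qdiv (- + 1 - sgn (alpha a)) (+ 2) ℚ.+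
        qdiv (modZ (modZ (- sgn (alpha a) * x ^ n * eval (tildeA A) x) (eval (tildeB a) x)) x) (+ ∣ alpha a ∣)
        ∎
      where open ≡-Reasoning

corollary3p2 : (d : ℕ) (A a : Vec ℤ d) (t : ℕ → ℕ) →
    + 0 ℤ.< coeff A 0 →
    coeff (Bpoly a) d ≢ + 0 →
    (∀ n → cauchy (Bpoly a) t n ≡ coeff A n) →
    (c : ℕ) → (∀ n → 1 ≤ n →
      (eval (tildeB a) ((+ c) ℤ.^ n) ≢ + 0) × (0 ℕ.< c ℕ.^ n) ×
      (+ t n ≡ modZ (fdiv ((+ c) ℤ.^ (n ℕ.* n) ℤ.* eval (tildeA A) ((+ c) ℤ.^ n)) (eval (tildeB a) ((+ c) ℤ.^ n))) ((+ c) ℤ.^ n))) →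
    Σ ℤ (λ e → (+ c ℤ.≤ e) × (∀ n → 1 ≤ n →
      (+ 0 ℤ.< eval (tildeB a) (e ℤ.^ n)) ×
      ((+ t n) ℚ./ 1 ≡ qdiv (ℤ.- (+ 1) ℤ.- sgn (alpha a)) (+ 2) ℚ.+ qdiv (modZ (modZ (ℤ.- sgn (alpha a) ℤ.* (e ℤ.^ (n ℕ.* n)) ℤ.* eval (tildeA A) (e ℤ.^ n)) (eval (tildeB a) (e ℤ.^ n))) (e ℤ.^ n)) (+ ℤ.∣ alpha a ∣))))
corollary3p2 zero    []  a t (+<+ ()) _ _ _ _
corollary3p2 (suc d') A a t A₀>0 b-top≢0 rec c _ = + e , +≤+ c≤e , λ
  { zero    ()
  ; (suc n') _ → conclusion e n' (1+z*hⁿ≤eⁿ Z n' H≤e 1+ZH≤e) }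
  where
  open Corollary d' A a t A₀>0 b-top≢0 rec

  e : ℕ
  e = c ℕ.+ H ℕ.+ Z ℕ.* H

  c≤e : c ≤ e
  c≤e = ℕP.≤-trans (ℕP.m≤m+n c H) (ℕP.m≤m+n (c ℕ.+ H) (Z ℕ.* H))

  H≤e : H ≤ e
  H≤e = ℕP.≤-trans (ℕP.m≤n+m H c) (ℕP.m≤m+n (c ℕ.+ H) (Z ℕ.* H))

  1+ZH≤e : suc (Z ℕ.* H) ≤ e
  1+ZH≤e = ℕP.+-monoˡ-≤ (Z ℕ.* H) (ℕP.≤-trans (s≤s z≤n) (ℕP.m≤n+m H c))
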